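{- For all integers $m\ge 3$ and $n\ge 2m-4$, we have $RS_{2,m}(n)=2$.
   Context: For $m\ge 3$, $E_m$ denotes the equation $x_1+x_2+\cdots+x_{m-1}=x_m$. For a positive integer $n$, $[1,n]=\{1,2,\ldots,n\}$. An $r$-coloring of a set $S$ is a map $S\to\{1,\ldots,r\}$; it is exact if it is surjective. A solution to $E_m$ in $[1,n]$ is a tuple $(x_1,\ldots,x_m)$ of (not necessarily distinct) elements of $[1,n]$ satisfying $E_m$. For $m\ge 3$ and $2\le t\le m$, the weakened rainbow Schur number $RS_{t,m}(n)$ is the minimum positive integer $r$ such that every exact $r$-coloring of $[1,n]$ admits a solution $(x_1,\ldots,x_m)$ to $E_m$ in $[1,n]$ whose entries $x_1,\ldots,x_m$ receive at least $t$ distinct colors. -}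

module Defs where

open import Data.Nat using (ℕ; zero; suc; _≤_; _<_)
open import Data.Fin using (Fin; toℕ; inject₁; fromℕ)
open import Data.List using (tabulate)
open import Data.Nat.ListAction using (sum)
open import Data.Product using (Σ; ∃; _×_)
open import Function using (_∘_)
open import Function.Definitions using (Injective)
open import Relation.Binary.PropositionalEquality using (_≡_)
open import Relation.Nullary using (¬_)
open import Data.Empty using (⊥)

-- [1,n] is represented by Fin n, where i : Fin n stands for the integer toℕ i + 1.
-- Colors {1,…,r} are represented by Fin r.
val : {n : ℕ} → Fin n → ℕ
val i = suc (toℕ i)

Exact : {n r : ℕ} → (Fin n → Fin r) → Set
Exact {n} {r} c = ∀ (y : Fin r) → ∃ λ (x : Fin n) → c x ≡ y

-- (x_1,…,x_m) solves E_m : x_1 + ⋯ + x_{m-1} = x_m   (entries in [1,n])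
IsSolution : (m : ℕ) {n : ℕ} → (Fin m → Fin n) → Set
IsSolution zero    x = ⊥
IsSolution (suc k) x = sum (tabulate (λ (j : Fin k) → val (x (inject₁ j)))) ≡ val (x (fromℕ k))

-- c admits a solution to E_m whose entries receive at least t distinct colors
-- (i.e. there are t positions whose colors are pairwise distinct)
HasSol : (t m : ℕ) {n r : ℕ} → (Fin n → Fin r) → Set
HasSol t m {n} c =
  Σ (Fin m → Fin n) λ x → IsSolution m x ×
    Σ (Fin t → Fin m) λ s → Injective _≡_ _≡_ (c ∘ x ∘ s)

Good : (t m n r : ℕ) → Set
Good t m n r = ∀ (c : Fin n → Fin r) → Exact c → HasSol t m c

IsRS : (t m n r : ℕ) → Set
IsRS t m n r = 1 ≤ r × Good t m n r × (∀ r′ → 1 ≤ r′ → r′ < r → ¬ Good t m n r′)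

-- An exact colouring with at least two colours colours some y differently from 1. With
-- k = m - 2, if y > k then (1,…,1, y - k, y) solves E_m, and if y ≤ k then (1,…,1, y, y + k)
-- does, where y + k ≤ 2k ≤ n keeps it inside [1,n]; either way the entries 1 and y differ in
-- colour. With a single colour no solution can show two colours.
module Submission where

open import Defs
open import Data.Nat using (ℕ; _≤_; _*_; _∸_; zero; suc; _+_; _<_; s≤s; z≤n; _≤?_)
open import Data.Nat.Properties
  using (≤-refl; ≤-trans; ≤-<-trans; <-≤-trans; ≰⇒>; m≤m+n; m∸n≤m; +-monoʳ-<; +-suc; +-assoc;
         +-identityʳ; *-identityʳ; *-distribˡ-+; m+n∸m≡n; m+[n∸m]≡n)
open import Data.Fin using (Fin; toℕ; inject₁; fromℕ; fromℕ<; _≟_)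
open import Data.Fin.Properties using (toℕ-fromℕ<; toℕ<n; injective⇒≤; 0≢1+n)
open import Data.Vec.Functional using ([]; _∷_)
open import Data.List using (tabulate)
open import Data.Nat.ListAction using (sum)
open import Data.Product using (∃; _,_)
open import Function.Definitions using (Injective)
open import Relation.Binary.PropositionalEquality
open import Relation.Nullary using (¬_; yes; no)
open import Data.Empty using (⊥-elim)

hasSol⇒≤ : ∀ {t m n r} {c : Fin n → Fin r} → HasSol t m c → t ≤ r
hasSol⇒≤ (_ , _ , _ , inj) = injective⇒≤ inj

¬good-one-colour : ∀ {t m n} → 2 ≤ t → 1 ≤ n → ¬ Good t m n 1
¬good-one-colour 2≤t (s≤s z≤n) good
  with ≤-trans 2≤t (hasSol⇒≤ (good (λ _ → Fin.zero) λ { Fin.zero → Fin.zero , refl }))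
... | s≤s ()

exact⇒other-colour : ∀ {n r} {c : Fin n → Fin r} → 2 ≤ r → Exact c →
  ∀ x → ∃ λ y → c x ≢ c y
exact⇒other-colour {c = c} (s≤s (s≤s z≤n)) exact x with c x ≟ Fin.zero
... | yes cx≡0 = let y , cy≡1 = exact (Fin.suc Fin.zero)
                 in y , λ cx≡cy → 0≢1+n (trans (sym cx≡0) (trans cx≡cy cy≡1))
... | no cx≢0 = let y , cy≡0 = exact Fin.zero
                in y , λ cx≡cy → cx≢0 (trans cx≡cy cy≡0)

injective-Fin2 : ∀ {a} {A : Set a} {f : Fin 2 → A} →
  f Fin.zero ≢ f (Fin.suc Fin.zero) → Injective _≡_ _≡_ f
injective-Fin2 _  {Fin.zero}         {Fin.zero}         _ = refl
injective-Fin2 ne {Fin.zero}         {Fin.suc Fin.zero} e = ⊥-elim (ne e)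
injective-Fin2 ne {Fin.suc Fin.zero} {Fin.zero}         e = ⊥-elim (ne (sym e))
injective-Fin2 _  {Fin.suc Fin.zero} {Fin.suc Fin.zero} _ = refl

hasSol-two-colours : ∀ {m n r} {c : Fin n → Fin r} (x : Fin m → Fin n) (p q : Fin m) →
  IsSolution m x → c (x p) ≢ c (x q) → HasSol 2 m c
hasSol-two-colours x p q sol ne = x , sol , p ∷ q ∷ [] , injective-Fin2 ne

padded : ∀ {n} (k : ℕ) → Fin n → Fin n → Fin n → Fin (2 + k) → Fin n
padded zero    u a b Fin.zero    = a
padded zero    u a b (Fin.suc _) = b
padded (suc k) u a b Fin.zero    = u
padded (suc k) u a b (Fin.suc i) = padded k u a b i

padded-last : ∀ {n} k (u a b : Fin n) → padded k u a b (fromℕ (suc k)) ≡ b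
padded-last zero    u a b = refl
padded-last (suc k) u a b = padded-last k u a b

padded-penultimate : ∀ {n} k (u a b : Fin n) → padded k u a b (inject₁ (fromℕ k)) ≡ a
padded-penultimate zero    u a b = refl
padded-penultimate (suc k) u a b = padded-penultimate k u a b

sum-padded : ∀ {n} k (u a b : Fin n) →
  sum (tabulate (λ (j : Fin (suc k)) → val (padded k u a b (inject₁ j)))) ≡ k * val u + val a
sum-padded zero    u a b = +-identityʳ (val a)
sum-padded (suc k) u a b = trans (cong (val u +_) (sum-padded k u a b))
                                 (sym (+-assoc (val u) (k * val u) (val a)))

padded-solution : ∀ {n} k {u a b : Fin n} → k * val u + val a ≡ val b →
  IsSolution (2 + k) (padded k u a b)
padded-solution k {u} {a} {b} eq =
  trans (sum-padded k u a b) (trans eq (cong val (sym (padded-last k u a b))))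

hasSol-of-other-colour : ∀ {k n r} {c : Fin (suc n) → Fin r} → 1 ≤ k → k + k ≤ suc n →
  ∀ y → c Fin.zero ≢ c y → HasSol 2 (2 + k) c
hasSol-of-other-colour {k} {n} {c = c} (s≤s z≤n) 2k≤n y c1≢cy with k ≤? toℕ y
... | yes k≤y =
  hasSol-two-colours {c = c} (padded k Fin.zero a y) Fin.zero (fromℕ (suc k))
    (padded-solution k k+a≡y)
    (λ e → c1≢cy (trans e (cong c (padded-last k Fin.zero a y))))
  where
    y∸k<n : toℕ y ∸ k < suc n
    y∸k<n = ≤-<-trans (m∸n≤m (toℕ y) k) (toℕ<n y)
    a : Fin (suc n)
    a = fromℕ< y∸k<n
    open ≡-Reasoning
    k+a≡y : k * 1 + val a ≡ val y
    k+a≡y = begin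
      k * 1 + suc (toℕ a)       ≡⟨ cong₂ _+_ (*-identityʳ k) (cong suc (toℕ-fromℕ< y∸k<n)) ⟩
      k + suc (toℕ y ∸ k)       ≡⟨ +-suc k _ ⟩
      suc (k + (toℕ y ∸ k))     ≡⟨ cong suc (m+[n∸m]≡n k≤y) ⟩
      val y                     ∎
... | no k≰y =
  hasSol-two-colours {c = c} (padded k Fin.zero y b) Fin.zero (inject₁ (fromℕ k))
    (padded-solution k k+y≡b)
    (λ e → c1≢cy (trans e (cong c (padded-penultimate k Fin.zero y b))))
  where
    k+y<n : k + toℕ y < suc n
    k+y<n = <-≤-trans (+-monoʳ-< k (≰⇒> k≰y)) 2k≤n
    b : Fin (suc n)
    b = fromℕ< k+y<n
    open ≡-Reasoning
    k+y≡b : k * 1 + val y ≡ val b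
    k+y≡b = begin
      k * 1 + suc (toℕ y)       ≡⟨ cong (_+ val y) (*-identityʳ k) ⟩
      k + suc (toℕ y)           ≡⟨ +-suc k _ ⟩
      suc (k + toℕ y)           ≡⟨ cong suc (sym (toℕ-fromℕ< k+y<n)) ⟩
      val b                     ∎

good-padded : ∀ {k n r} → 1 ≤ k → k + k ≤ n → 2 ≤ r → Good 2 (2 + k) n r
good-padded {n = zero}  (s≤s z≤n) ()
good-padded {n = suc _} 1≤k 2k≤n 2≤r c exact =
  let y , c1≢cy = exact⇒other-colour {c = c} 2≤r exact Fin.zero
  in hasSol-of-other-colour {c = c} 1≤k 2k≤n y c1≢cy

2[2+k]∸4≡k+k : ∀ k → 2 * (2 + k) ∸ 4 ≡ k + k
2[2+k]∸4≡k+k k = begin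
  2 * (2 + k) ∸ 4     ≡⟨ cong (_∸ 4) (*-distribˡ-+ 2 2 k) ⟩
  4 + 2 * k ∸ 4       ≡⟨ m+n∸m≡n 4 (2 * k) ⟩
  k + (k + 0)         ≡⟨ cong (k +_) (+-identityʳ k) ⟩
  k + k               ∎
  where open ≡-Reasoning

theorem6 : ∀ (m n : ℕ) → 3 ≤ m → 2 * m ∸ 4 ≤ n → IsRS 2 m n 2
theorem6 (suc (suc k)) n (s≤s (s≤s 1≤k)) bound =
  s≤s z≤n , good-padded 1≤k 2k≤n ≤-refl , below
  where
    2k≤n : k + k ≤ n
    2k≤n = subst (_≤ n) (2[2+k]∸4≡k+k k) bound
    below : ∀ r′ → 1 ≤ r′ → r′ < 2 → ¬ Good 2 (2 + k) n r′
    below (suc zero)    _ _ = ¬good-one-colour ≤-refl (≤-trans 1≤k (≤-trans (m≤m+n k k) 2k≤n))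
    below (suc (suc _)) _ (s≤s (s≤s ()))
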